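{- For every integer $n\ge 0$, there is a bijection between $P_2(0,n)$ and $U_5(0,n)$.
   Context: Durfee symbol of a partition $\lambda$. Set $\lambda_k=0$ for $k>\ell(\lambda)$. Let $d=\max\{k:\lambda_k\ge k\}$, with $d=0$ for the empty partition. Then $$\alpha=(\lambda_1-d,\ldots,\lambda_d-d)',$$ the conjugate of the partition formed by the positive entries, and $$\beta=(\lambda_{d+1},\ldots,\lambda_{\ell(\lambda)}).$$ This is written $(\alpha,\beta)_d$. Parts beyond the length are taken to be $0$. $P(0,n)$ is the set of partitions of $n$ with rank $0$, equivalently with Durfee symbol satisfying $\ell(\alpha)=\ell(\beta)$. $P_2(0,n)$ is the subset of $P(0,n)$ where $\beta_1<d$ and $\alpha_1=d$. $U(0,n)$ is the set of partitions of $n$ with Durfee symbol $(\gamma,\delta)_{d'}$ such that $\ell(\gamma)-\ell(\delta)\le 0$ and $\gamma_1\le d'-1$. $U_5(0,n)$ is the subset of $U(0,n)$ where $\ell(\gamma)=\ell(\delta)$ and $\delta_1=d'$. -}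

module Defs where

open import Data.Nat using (ℕ; zero; suc; _+_; _∸_; _≤_; _<_; _≤?_; _<?_; _⊔_)
open import Data.List using (List; []; _∷_; length; map; filter; drop; foldr; upTo)
open import Data.Nat.ListAction using (sum)
open import Data.List.Relation.Unary.All using (All)
open import Data.List.Relation.Unary.Linked using (Linked)
open import Data.Product using (Σ; _×_)
open import Relation.Binary.PropositionalEquality using (_≡_)
open import Data.Nat using (_≥_)

IsPartition : List ℕ → Set
IsPartition λs = All (λ x → 0 < x) λs × Linked _≥_ λs

IsPartitionOf : ℕ → List ℕ → Set
IsPartitionOf n λs = IsPartition λs × sum λs ≡ n

-- k-th part (1-indexed), with parts beyond the length equal to 0
part : List ℕ → ℕ → ℕ
part []       _             = 0
part (x ∷ xs) zero          = 0   -- index 0 is not used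
part (x ∷ xs) (suc zero)    = x
part (x ∷ xs) (suc (suc k)) = part xs (suc k)

oneTo : ℕ → List ℕ
oneTo m = map suc (upTo m)

maximum : List ℕ → ℕ
maximum = foldr _⊔_ 0

-- Durfee number d = max { k : λ_k ≥ k }, 0 if the set is empty.
-- (Any such k satisfies 1 ≤ k ≤ λ_k, hence k ≤ ℓ(λ); so searching
--  k ∈ {1,…,ℓ(λ)} loses nothing.)
durfee : List ℕ → ℕ
durfee λs = maximum (filter (λ k → k ≤? part λs k) (oneTo (length λs)))

conj : List ℕ → List ℕ
conj μ = map (λ j → length (filter (λ x → j ≤? x) μ)) (oneTo (maximum μ))

record DurfeeSymbol : Set where
  constructor ⟨_,_⟩[_]
  field
    α : List ℕ
    β : List ℕ
    d : ℕ

durfeeSymbol : List ℕ → DurfeeSymbol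
durfeeSymbol λs = ⟨ conj (filter (λ x → 0 <? x) (map (λ i → part λs i ∸ d) (oneTo d)))
                  , drop d λs ⟩[ d ]
  where d = durfee λs

-- first part (0 for the empty partition)
first : List ℕ → ℕ
first μ = part μ 1

-- rank of a partition: largest part minus number of parts; rank 0 ⇔ λ₁ = ℓ(λ)
RankZero : List ℕ → Set
RankZero λs = first λs ≡ length λs

InP0 : ℕ → List ℕ → Set
InP0 n λs = IsPartitionOf n λs × RankZero λs

InP2 : ℕ → List ℕ → Set
InP2 n λs = InP0 n λs × (first (β S) < d S × first (α S) ≡ d S)
  where
    S = durfeeSymbol λs
    open DurfeeSymbol

-- U(0,n): Durfee symbol (γ,δ)_{d'} with ℓ(γ) - ℓ(δ) ≤ 0 and γ₁ ≤ d' - 1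
-- (the latter stated over ℤ, i.e. γ₁ + 1 ≤ d', written γ₁ < d')
InU0 : ℕ → List ℕ → Set
InU0 n λs = IsPartitionOf n λs × (length (α S) ≤ length (β S) × first (α S) < d S)
  where
    S = durfeeSymbol λs
    open DurfeeSymbol

InU5 : ℕ → List ℕ → Set
InU5 n λs = InU0 n λs × (length (α S) ≡ length (β S) × first (β S) ≡ d S)
  where
    S = durfeeSymbol λs
    open DurfeeSymbol

P₂ : ℕ → Set
P₂ n = Σ (List ℕ) (InP2 n)

U₅ : ℕ → Set
U₅ n = Σ (List ℕ) (InU5 n)

-- Conjugation is the bijection. Writing d for the Durfee size, a partition of
-- rank 0 lies in P₂(0,n) exactly when λ_d > d > λ_{d+1}, and in U₅(0,n) exactly
-- when λ_d = d = λ_{d+1}. Through the Galois connection k ≤ λ_j ⇔ j ≤ λ'_k the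
-- first corner shape of λ becomes the second one of λ', and vice versa, while
-- conjugation preserves size, rank 0 and is an involution.
module Submission where

open import Defs
open import Data.Nat using (ℕ; zero; suc; _+_; _∸_; _≤_; _<_; _≥_; _≤?_; _<?_; z≤n; s≤s; s≤s⁻¹)
open import Data.Nat.Properties
open import Data.Nat.ListAction using (sum)
open import Data.List using (List; []; _∷_; length; map; filter; drop; applyUpTo)
open import Data.List.Properties using (length-applyUpTo; map-applyUpTo; map-upTo; filter-all; filter-notAll; filter-accept; filter-reject; length-drop)
open import Data.List.Relation.Unary.All as All using (All; []; _∷_)
open import Data.List.Relation.Unary.All.Properties using (applyUpTo⁺₁; all-filter; filter⁺)
open import Data.List.Relation.Unary.Any as Any using (here; there)
open import Data.List.Relation.Unary.Linked as Linked using (Linked)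
open import Data.List.Relation.Unary.Linked.Properties using (Linked⇒All; applyUpTo⁺₂)
open import Data.List.Membership.Propositional using (_∈_)
open import Data.List.Membership.Propositional.Properties using (∈-applyUpTo⁺; ∈-filter⁺; ∈-map⁺; ∈-upTo⁺)
open import Data.Product using (∃; _×_; _,_; proj₁; proj₂)
open import Data.Sum using (_⊎_; inj₁; inj₂)
open import Function using (_∘_)
open import Function.Bundles using (_⤖_; _⇔_; mk⇔; mk↔ₛ′; Equivalence)
open import Function.Properties.Inverse using (↔⇒⤖)
open import Relation.Nullary.Irrelevant using (Irrelevant)
open import Algebra.Properties.CommutativeSemigroup +-commutativeSemigroup using (interchange)
open import Relation.Nullary using (¬_; yes; no; contradiction)
open import Relation.Binary.PropositionalEquality

Decreasing : List ℕ → Set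
Decreasing = Linked _≥_

tail-≤-head : ∀ {x xs} → Decreasing (x ∷ xs) → All (_≤ x) xs
tail-≤-head dec = All.tail (Linked⇒All (λ p q → ≤-trans q p) ≤-refl dec)

part-bounded : ∀ {k L} → All (_≤ k) L → ∀ j → part L j ≤ k
part-bounded []      j             = z≤n
part-bounded (_ ∷ _) zero          = z≤n
part-bounded (p ∷ _) (suc zero)    = p
part-bounded (_ ∷ a) (suc (suc j)) = part-bounded a (suc j)

part-antitone : ∀ L → Decreasing L → ∀ {i j} → i ≤ j → part L (suc j) ≤ part L (suc i)
part-antitone []       dec                   p       = z≤n
part-antitone (x ∷ xs) dec {zero}  {j}       p       = part-bounded (≤-refl ∷ tail-≤-head dec) (suc j)
part-antitone (x ∷ xs) dec {suc i} {suc j} (s≤s p) = part-antitone xs (Linked.tail dec) p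

part-pos⇒<length : ∀ L i → 0 < part L (suc i) → i < length L
part-pos⇒<length (x ∷ xs) zero    p = s≤s z≤n
part-pos⇒<length (x ∷ xs) (suc i) p = s≤s (part-pos⇒<length xs i p)

part-drop : ∀ d L k → part (drop d L) (suc k) ≡ part L (suc (d + k))
part-drop zero    L        k = refl
part-drop (suc d) []       k = refl
part-drop (suc d) (x ∷ xs) k = part-drop d xs k

first-drop : ∀ d L → first (drop d L) ≡ part L (suc d)
first-drop d L = trans (part-drop d L 0) (cong (part L ∘ suc) (+-identityʳ d))

part-applyUpTo-< : ∀ f m i → i < m → part (applyUpTo f m) (suc i) ≡ f i
part-applyUpTo-< f (suc m) zero    p       = refl
part-applyUpTo-< f (suc m) (suc i) (s≤s p) = part-applyUpTo-< (f ∘ suc) m i p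

part-applyUpTo-≥ : ∀ f m i → m ≤ i → part (applyUpTo f m) (suc i) ≡ 0
part-applyUpTo-≥ f zero    i       p       = refl
part-applyUpTo-≥ f (suc m) (suc i) (s≤s p) = part-applyUpTo-≥ (f ∘ suc) m i p

map-oneTo : ∀ (g : ℕ → ℕ) n → map g (oneTo n) ≡ applyUpTo (g ∘ suc) n
map-oneTo g n = trans (cong (map g) (map-upTo suc n)) (map-applyUpTo suc g n)

applyUpTo-cong : ∀ {f g : ℕ → ℕ} M → (∀ i → f i ≡ g i) → applyUpTo f M ≡ applyUpTo g M
applyUpTo-cong zero    eq = refl
applyUpTo-cong (suc M) eq = cong₂ _∷_ (eq 0) (applyUpTo-cong M (eq ∘ suc))

sum-applyUpTo-+ : ∀ (f g : ℕ → ℕ) M →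
                  sum (applyUpTo (λ i → f i + g i) M) ≡ sum (applyUpTo f M) + sum (applyUpTo g M)
sum-applyUpTo-+ f g zero    = refl
sum-applyUpTo-+ f g (suc M) = trans (cong (f 0 + g 0 +_) (sum-applyUpTo-+ (f ∘ suc) (g ∘ suc) M))
  (interchange (f 0) (g 0) (sum (applyUpTo (f ∘ suc) M)) (sum (applyUpTo (g ∘ suc) M)))

sum-applyUpTo-0 : ∀ {f : ℕ → ℕ} M → (∀ i → f i ≡ 0) → sum (applyUpTo f M) ≡ 0
sum-applyUpTo-0 zero    eq = refl
sum-applyUpTo-0 (suc M) eq = cong₂ _+_ (eq 0) (sum-applyUpTo-0 M (eq ∘ suc))

part-injective : ∀ A B → All (0 <_) A → All (0 <_) B → (∀ i → part A (suc i) ≡ part B (suc i)) → A ≡ B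
part-injective []      []      _        _        eq = refl
part-injective []      (b ∷ B) _        (b>0 ∷ _) eq = contradiction (eq 0) (<⇒≢ b>0)
part-injective (a ∷ A) []      (a>0 ∷ _) _        eq = contradiction (sym (eq 0)) (<⇒≢ a>0)
part-injective (a ∷ A) (b ∷ B) (_ ∷ pA) (_ ∷ pB) eq =
  cong₂ _∷_ (eq 0) (part-injective A B pA pB (eq ∘ suc))

all≤maximum : ∀ L → All (_≤ maximum L) L
all≤maximum []       = []
all≤maximum (x ∷ xs) =
  m≤m⊔n x (maximum xs) ∷ All.map (λ p → ≤-trans p (m≤n⊔m x (maximum xs))) (all≤maximum xs)

maximum-least : ∀ {v} L → All (_≤ v) L → maximum L ≤ v
maximum-least []       []      = z≤n
maximum-least (x ∷ xs) (p ∷ a) = ⊔-lub p (maximum-least xs a)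

∈⇒≤maximum : ∀ {v} L → v ∈ L → v ≤ maximum L
∈⇒≤maximum (x ∷ xs) (here refl) = m≤m⊔n x (maximum xs)
∈⇒≤maximum (x ∷ xs) (there v∈) = ≤-trans (∈⇒≤maximum xs v∈) (m≤n⊔m x (maximum xs))

maximum-unique : ∀ {v} L → All (_≤ v) L → v ≡ 0 ⊎ v ∈ L → maximum L ≡ v
maximum-unique L a (inj₁ refl) = n≤0⇒n≡0 (maximum-least L a)
maximum-unique L a (inj₂ v∈)   = ≤-antisym (maximum-least L a) (∈⇒≤maximum L v∈)

maximum-decreasing : ∀ L → Decreasing L → maximum L ≡ first L
maximum-decreasing []       dec = refl
maximum-decreasing (x ∷ xs) dec = maximum-unique (x ∷ xs) (≤-refl ∷ tail-≤-head dec) (inj₂ (here refl))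

count≥ : ℕ → List ℕ → ℕ
count≥ k L = length (filter (k ≤?_) L)

count≥-accept : ∀ {k x} xs → k ≤ x → count≥ k (x ∷ xs) ≡ suc (count≥ k xs)
count≥-accept {k} xs p = cong length (filter-accept (k ≤?_) p)

count≥-reject : ∀ {k x} xs → ¬ k ≤ x → count≥ k (x ∷ xs) ≡ count≥ k xs
count≥-reject {k} xs p = cong length (filter-reject (k ≤?_) p)

count≥-all< : ∀ {k} xs → All (_< k) xs → count≥ k xs ≡ 0
count≥-all< []       []           = refl
count≥-all< (x ∷ xs) (x<k ∷ x<ks) = trans (count≥-reject xs (<⇒≱ x<k)) (count≥-all< xs x<ks)

count≥-antitone : ∀ {k k′} L → k ≤ k′ → count≥ k′ L ≤ count≥ k L
count≥-antitone []       p = z≤n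
count≥-antitone {k} {k′} (x ∷ xs) p with k′ ≤? x | k ≤? x
... | yes a | yes b rewrite count≥-accept xs a | count≥-accept xs b = s≤s (count≥-antitone xs p)
... | yes a | no b  = contradiction (≤-trans p a) b
... | no a  | yes b rewrite count≥-reject xs a | count≥-accept xs b = m≤n⇒m≤1+n (count≥-antitone xs p)
... | no a  | no b  rewrite count≥-reject xs a | count≥-reject xs b = count≥-antitone xs p

≤part⇒≤count≥ : ∀ L → Decreasing L → ∀ j k → suc k ≤ part L (suc j) → suc j ≤ count≥ (suc k) L
≤part⇒≤count≥ (x ∷ xs) dec j k p with suc k ≤? x
≤part⇒≤count≥ (x ∷ xs) dec zero    k p | yes q rewrite count≥-accept xs q = s≤s z≤n
≤part⇒≤count≥ (x ∷ xs) dec (suc j) k p | yes q rewrite count≥-accept xs q =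
  s≤s (≤part⇒≤count≥ xs (Linked.tail dec) j k p)
... | no q = contradiction (≤-trans p (part-bounded (≤-refl ∷ tail-≤-head dec) (suc j))) q

≤count≥⇒≤part : ∀ L → Decreasing L → ∀ j k → suc j ≤ count≥ (suc k) L → suc k ≤ part L (suc j)
≤count≥⇒≤part (x ∷ xs) dec j k p with suc k ≤? x
≤count≥⇒≤part (x ∷ xs) dec zero    k p | yes q = q
≤count≥⇒≤part (x ∷ xs) dec (suc j) k p | yes q rewrite count≥-accept xs q =
  ≤count≥⇒≤part xs (Linked.tail dec) j k (s≤s⁻¹ p)
... | no q = contradiction (subst (suc j ≤_) nothing-counted p) λ ()
  where
  nothing-counted : count≥ (suc k) (x ∷ xs) ≡ 0
  nothing-counted = trans (count≥-reject xs q)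
    (count≥-all< xs (All.map (λ y≤x → ≤-<-trans y≤x (≰⇒> q)) (tail-≤-head dec)))

conj≡applyUpTo : ∀ μ → conj μ ≡ applyUpTo (λ i → count≥ (suc i) μ) (maximum μ)
conj≡applyUpTo μ = map-oneTo (λ j → count≥ j μ) (maximum μ)

length-conj : ∀ μ → length (conj μ) ≡ maximum μ
length-conj μ = trans (cong length (conj≡applyUpTo μ)) (length-applyUpTo _ (maximum μ))

part-conj : ∀ μ i → part (conj μ) (suc i) ≡ count≥ (suc i) μ
part-conj μ i rewrite conj≡applyUpTo μ with i <? maximum μ
... | yes i<max = part-applyUpTo-< _ _ i i<max
... | no i≮max  = trans (part-applyUpTo-≥ _ _ i (≮⇒≥ i≮max))
  (sym (count≥-all< μ (All.map (λ p → s≤s (≤-trans p (≮⇒≥ i≮max))) (all≤maximum μ))))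

first-conj : ∀ μ → All (0 <_) μ → first (conj μ) ≡ length μ
first-conj μ pos = trans (part-conj μ 0) (cong length (filter-all (1 ≤?_) pos))

conj-isPartition : ∀ μ → IsPartition μ → IsPartition (conj μ)
conj-isPartition μ (pos , dec) rewrite conj≡applyUpTo μ =
    applyUpTo⁺₁ _ _ (λ {i} i<max → ≤part⇒≤count≥ μ dec 0 i (subst (suc i ≤_) (maximum-decreasing μ dec) i<max))
  , applyUpTo⁺₂ _ _ (λ i → count≥-antitone μ (n≤1+n (suc i)))

≤part⇒≤part-conj : ∀ L → Decreasing L → ∀ {j k} → suc k ≤ part L (suc j) → suc j ≤ part (conj L) (suc k)
≤part⇒≤part-conj L dec {j} {k} p = subst (suc j ≤_) (sym (part-conj L k)) (≤part⇒≤count≥ L dec j k p)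

≤part-conj⇒≤part : ∀ L → Decreasing L → ∀ {j k} → suc j ≤ part (conj L) (suc k) → suc k ≤ part L (suc j)
≤part-conj⇒≤part L dec {j} {k} p = ≤count≥⇒≤part L dec j k (subst (suc j ≤_) (part-conj L k) p)

part<⇒part-conj< : ∀ L → Decreasing L → ∀ {j k} → part L (suc j) < suc k → part (conj L) (suc k) < suc j
part<⇒part-conj< L dec p = ≰⇒> (λ q → <⇒≱ p (≤part-conj⇒≤part L dec q))

lower-bounds⇒≤ : ∀ {a b} → (∀ i → suc i ≤ a → suc i ≤ b) → a ≤ b
lower-bounds⇒≤ {zero}  h = z≤n
lower-bounds⇒≤ {suc a} h = h a ≤-refl

conj-involutive : ∀ μ → IsPartition μ → conj (conj μ) ≡ μ
conj-involutive μ μ-part@(pos , dec) =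
  part-injective (conj (conj μ)) μ (proj₁ (conj-isPartition _ conj-part)) pos λ j → ≤-antisym
    (lower-bounds⇒≤ λ i → ≤part-conj⇒≤part μ dec ∘ ≤part-conj⇒≤part (conj μ) conj-dec)
    (lower-bounds⇒≤ λ i → ≤part⇒≤part-conj (conj μ) conj-dec ∘ ≤part⇒≤part-conj μ dec)
  where
  conj-part = conj-isPartition μ μ-part
  conj-dec  = proj₂ conj-part

conj-rankZero : ∀ μ → IsPartition μ → RankZero μ → RankZero (conj μ)
conj-rankZero μ (pos , dec) rank = begin
  first (conj μ)   ≡⟨ first-conj μ pos ⟩
  length μ         ≡⟨ rank ⟨
  first μ          ≡⟨ maximum-decreasing μ dec ⟨
  maximum μ        ≡⟨ length-conj μ ⟨
  length (conj μ)  ∎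
  where open ≡-Reasoning

count≥-∷ : ∀ k x xs → count≥ k (x ∷ xs) ≡ count≥ k (x ∷ []) + count≥ k xs
count≥-∷ k x xs with k ≤? x
... | yes p rewrite count≥-accept xs p | count≥-accept [] p = refl
... | no p  rewrite count≥-reject xs p | count≥-reject [] p = refl

sum-count≥-singleton : ∀ M x → x ≤ M → sum (applyUpTo (λ i → count≥ (suc i) (x ∷ [])) M) ≡ x
sum-count≥-singleton M       zero    p       = sum-applyUpTo-0 M (λ _ → refl)
sum-count≥-singleton (suc M) (suc x) (s≤s p) = cong suc (begin
  sum (applyUpTo (λ i → count≥ (suc (suc i)) (suc x ∷ [])) M)  ≡⟨ cong sum (applyUpTo-cong M shift) ⟩
  sum (applyUpTo (λ i → count≥ (suc i) (x ∷ [])) M)            ≡⟨ sum-count≥-singleton M x p ⟩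
  x                                                            ∎)
  where
  open ≡-Reasoning
  shift : ∀ i → count≥ (suc (suc i)) (suc x ∷ []) ≡ count≥ (suc i) (x ∷ [])
  shift i with suc i ≤? x
  ... | yes q rewrite count≥-accept [] q | count≥-accept {suc (suc i)} [] (s≤s q) = refl
  ... | no q  rewrite count≥-reject [] q | count≥-reject {suc (suc i)} [] (q ∘ s≤s⁻¹) = refl

sum-count≥ : ∀ M μ → All (_≤ M) μ → sum (applyUpTo (λ i → count≥ (suc i) μ) M) ≡ sum μ
sum-count≥ M []       []      = sum-applyUpTo-0 M (λ _ → refl)
sum-count≥ M (x ∷ xs) (p ∷ a) = begin
  sum (applyUpTo (λ i → count≥ (suc i) (x ∷ xs)) M)
    ≡⟨ cong sum (applyUpTo-cong M (λ i → count≥-∷ (suc i) x xs)) ⟩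
  sum (applyUpTo (λ i → count≥ (suc i) (x ∷ []) + count≥ (suc i) xs) M)
    ≡⟨ sum-applyUpTo-+ _ _ M ⟩
  sum (applyUpTo (λ i → count≥ (suc i) (x ∷ [])) M) + sum (applyUpTo (λ i → count≥ (suc i) xs) M)
    ≡⟨ cong₂ _+_ (sum-count≥-singleton M x p) (sum-count≥ M xs a) ⟩
  x + sum xs ∎
  where open ≡-Reasoning

sum-conj : ∀ μ → sum (conj μ) ≡ sum μ
sum-conj μ = trans (cong sum (conj≡applyUpTo μ)) (sum-count≥ (maximum μ) μ (all≤maximum μ))

durfee≡ : ∀ L e → Decreasing L → suc e ≤ part L (suc e) → part L (suc (suc e)) < suc (suc e) → durfee L ≡ suc e
durfee≡ L e dec p q = maximum-unique candidates (All.map bounded (all-filter P? (oneTo (length L))))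
  (inj₂ (∈-filter⁺ P? (∈-map⁺ suc (∈-upTo⁺ (part-pos⇒<length L e (≤-trans (s≤s z≤n) p)))) p))
  where
  P? = λ k → k ≤? part L k
  candidates = filter P? (oneTo (length L))
  bounded : ∀ {k} → k ≤ part L k → k ≤ suc e
  bounded {zero}  _ = z≤n
  bounded {suc k} k≤part with suc k ≤? suc e
  ... | yes k≤e = k≤e
  ... | no  k≰e = contradiction
    (≤-trans k≤part (part-antitone L dec (s≤s⁻¹ (≰⇒> k≰e)))) (<⇒≱ (<-≤-trans q (≰⇒> k≰e)))

StrictCorner : ℕ → List ℕ → Set
StrictCorner d L = d < part L d × part L (suc d) < d

FlatCorner : ℕ → List ℕ → Set
FlatCorner d L = part L d ≤ d × d ≤ part L (suc d)

durfee-strict : ∀ L e → Decreasing L → StrictCorner (suc e) L → durfee L ≡ suc e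
durfee-strict L e dec (p , q) = durfee≡ L e dec (<⇒≤ p) (m<n⇒m<1+n q)

flat⇒≤part : ∀ L e → Decreasing L → FlatCorner (suc e) L → suc e ≤ part L (suc e)
flat⇒≤part L e dec (_ , q) = ≤-trans q (part-antitone L dec (n≤1+n e))

durfee-flat : ∀ L e → Decreasing L → FlatCorner (suc e) L → durfee L ≡ suc e
durfee-flat L e dec flat@(p , _) =
  durfee≡ L e dec (flat⇒≤part L e dec flat) (s≤s (≤-trans (part-antitone L dec (n≤1+n e)) p))

conj-strict⇒flat : ∀ L e → Decreasing L → StrictCorner (suc e) L → FlatCorner (suc e) (conj L)
conj-strict⇒flat L e dec (p , q) = s≤s⁻¹ (part<⇒part-conj< L dec q) , ≤part⇒≤part-conj L dec p

conj-flat⇒strict : ∀ L e → Decreasing L → FlatCorner (suc e) L → StrictCorner (suc e) (conj L)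
conj-flat⇒strict L e dec (p , q) = ≤part⇒≤part-conj L dec q , part<⇒part-conj< L dec (s≤s p)

-- The Durfee symbol: α = conj (arm L d), β = drop d L

arm : List ℕ → ℕ → List ℕ
arm L d = filter (0 <?_) (map (λ i → part L i ∸ d) (oneTo d))

arm≡ : ∀ L d → arm L d ≡ filter (0 <?_) (applyUpTo (λ i → part L (suc i) ∸ d) d)
arm≡ L d = cong (filter (0 <?_)) (map-oneTo (λ i → part L i ∸ d) d)

arm-positive : ∀ L d → All (0 <_) (arm L d)
arm-positive L d = all-filter (0 <?_) (map (λ i → part L i ∸ d) (oneTo d))

length-arm-full : ∀ L e → Decreasing L → suc e < part L (suc e) → length (arm L (suc e)) ≡ suc e
length-arm-full L e dec p = begin
  length (arm L (suc e))  ≡⟨ cong length (arm≡ L (suc e)) ⟩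
  length (filter (0 <?_) (applyUpTo g (suc e)))
    ≡⟨ cong length (filter-all (0 <?_) (applyUpTo⁺₁ g (suc e) (λ i<d → m<n⇒0<n∸m (≤-trans p (part-antitone L dec (s≤s⁻¹ i<d)))))) ⟩
  length (applyUpTo g (suc e))  ≡⟨ length-applyUpTo g (suc e) ⟩
  suc e                         ∎
  where
  open ≡-Reasoning
  g = λ i → part L (suc i) ∸ suc e

length-arm-short : ∀ L e → part L (suc e) ≤ suc e → length (arm L (suc e)) < suc e
length-arm-short L e p = begin-strict
  length (arm L (suc e))                         ≡⟨ cong length (arm≡ L (suc e)) ⟩
  length (filter (0 <?_) (applyUpTo g (suc e)))  <⟨ filter-notAll (0 <?_) _ (Any.map last-vanishes (∈-applyUpTo⁺ g (n<1+n e))) ⟩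
  length (applyUpTo g (suc e))                   ≡⟨ length-applyUpTo g (suc e) ⟩
  suc e                                          ∎
  where
  open ≤-Reasoning
  g = λ i → part L (suc i) ∸ suc e
  last-vanishes : ∀ {x} → g e ≡ x → ¬ 0 < x
  last-vanishes refl = <-irrefl (sym (m≤n⇒m∸n≡0 p))

maximum-arm : ∀ L e → Decreasing L → maximum (arm L (suc e)) ≡ first L ∸ suc e
maximum-arm L e dec = trans (cong maximum (arm≡ L (suc e))) (maximum-unique _ bounded attained)
  where
  g = λ i → part L (suc i) ∸ suc e
  bounded : All (_≤ first L ∸ suc e) (filter (0 <?_) (applyUpTo g (suc e)))
  bounded = filter⁺ (0 <?_) (applyUpTo⁺₁ g (suc e) (λ _ → ∸-monoˡ-≤ (suc e) (part-antitone L dec z≤n)))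
  attained : first L ∸ suc e ≡ 0 ⊎ first L ∸ suc e ∈ filter (0 <?_) (applyUpTo g (suc e))
  attained with 0 <? g 0
  ... | yes g0>0 = inj₂ (∈-filter⁺ (0 <?_) (∈-applyUpTo⁺ g (s≤s z≤n)) g0>0)
  ... | no  g0≯0 = inj₁ (n≤0⇒n≡0 (≮⇒≥ g0≯0))

first-α : ∀ L d → first (conj (arm L d)) ≡ length (arm L d)
first-α L d = first-conj (arm L d) (arm-positive L d)

length-α : ∀ L e → Decreasing L → length (conj (arm L (suc e))) ≡ first L ∸ suc e
length-α L e dec = trans (length-conj (arm L (suc e))) (maximum-arm L e dec)

-- The Durfee size is passed as D with D ≡ suc e so that matching on refl can replace durfee L.
strict⇒P₂-symbol : ∀ L e D → Decreasing L → StrictCorner (suc e) L → D ≡ suc e →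
                   first (drop D L) < D × first (conj (arm L D)) ≡ D
strict⇒P₂-symbol L e _ dec (p , q) refl =
  subst (_< suc e) (sym (first-drop (suc e) L)) q , trans (first-α L (suc e)) (length-arm-full L e dec p)

P₂-symbol⇒strict : ∀ L D → Decreasing L → first (drop D L) < D → first (conj (arm L D)) ≡ D →
                   ∃ λ e → StrictCorner (suc e) L
P₂-symbol⇒strict L zero    dec ()   _
P₂-symbol⇒strict L (suc e) dec β₁<d α₁≡d =
  e , ≰⇒> (λ p → <⇒≢ (length-arm-short L e p) (trans (sym (first-α L (suc e))) α₁≡d))
    , subst (_< suc e) (first-drop (suc e) L) β₁<d

flat⇒U₅-symbol : ∀ L e D → Decreasing L → FlatCorner (suc e) L → D ≡ suc e →
                 first (conj (arm L D)) < D × first (drop D L) ≡ D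
flat⇒U₅-symbol L e _ dec (p , q) refl =
    subst (_< suc e) (sym (first-α L (suc e))) (length-arm-short L e p)
  , trans (first-drop (suc e) L) (≤-antisym (≤-trans (part-antitone L dec (n≤1+n e)) p) q)

U₅-symbol⇒flat : ∀ L D → Decreasing L → first (conj (arm L D)) < D → first (drop D L) ≡ D →
                 ∃ λ e → FlatCorner (suc e) L
U₅-symbol⇒flat L zero    dec ()   _
U₅-symbol⇒flat L (suc e) dec α₁<d β₁≡d =
  e , ≮⇒≥ (λ p → <⇒≢ α₁<d (trans (first-α L (suc e)) (length-arm-full L e dec p)))
    , ≤-reflexive (trans (sym β₁≡d) (first-drop (suc e) L))

-- Given λ_d ≥ d, both ℓ(α) = λ₁ − d and ℓ(β) = ℓ(λ) − d are untruncated differences.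
ℓα≡ℓβ⇔RankZero : ∀ L e D → Decreasing L → suc e ≤ part L (suc e) → D ≡ suc e →
                 (length (conj (arm L D)) ≡ length (drop D L)) ⇔ RankZero L
ℓα≡ℓβ⇔RankZero L e _ dec p refl = mk⇔
  (λ ℓα≡ℓβ → ∸-cancelʳ-≡ d≤first d≤length (trans (sym (length-α L e dec)) (trans ℓα≡ℓβ (length-drop (suc e) L))))
  (λ rank → trans (length-α L e dec) (trans (cong (_∸ suc e) rank) (sym (length-drop (suc e) L))))
  where
  d≤first  = ≤-trans p (part-antitone L dec z≤n)
  d≤length = part-pos⇒<length L e (≤-trans (s≤s z≤n) p)

InP2⇒strict : ∀ {n L} → InP2 n L → ∃ λ e → StrictCorner (suc e) L
InP2⇒strict {L = L} ((((_ , dec) , _) , _) , β₁<d , α₁≡d) = P₂-symbol⇒strict L (durfee L) dec β₁<d α₁≡d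

strict⇒InP2 : ∀ {n L e} → InP0 n L → StrictCorner (suc e) L → InP2 n L
strict⇒InP2 {L = L} {e} p0@(((_ , dec) , _) , _) strict =
  p0 , strict⇒P₂-symbol L e (durfee L) dec strict (durfee-strict L e dec strict)

InU5⇒flat : ∀ {n L} → InU5 n L → ∃ λ e → FlatCorner (suc e) L
InU5⇒flat {L = L} ((((_ , dec) , _) , _ , α₁<d) , _ , β₁≡d) = U₅-symbol⇒flat L (durfee L) dec α₁<d β₁≡d

InU5⇒InP0 : ∀ {n L} → InU5 n L → InP0 n L
InU5⇒InP0 {L = L} u@(((pn@((_ , dec) , _) , _) , ℓα≡ℓβ , _)) =
  pn , Equivalence.to (ℓα≡ℓβ⇔RankZero L e (durfee L) dec (flat⇒≤part L e dec flat) (durfee-flat L e dec flat)) ℓα≡ℓβ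
  where
  e    = proj₁ (InU5⇒flat u)
  flat = proj₂ (InU5⇒flat u)

flat⇒InU5 : ∀ {n L e} → InP0 n L → FlatCorner (suc e) L → InU5 n L
flat⇒InU5 {L = L} {e} (pn@((_ , dec) , _) , rank) flat =
  (pn , ≤-reflexive ℓα≡ℓβ , proj₁ symbol) , ℓα≡ℓβ , proj₂ symbol
  where
  d≡e+1  = durfee-flat L e dec flat
  symbol = flat⇒U₅-symbol L e (durfee L) dec flat d≡e+1
  ℓα≡ℓβ  = Equivalence.from (ℓα≡ℓβ⇔RankZero L e (durfee L) dec (flat⇒≤part L e dec flat) d≡e+1) rank

conj-InP0 : ∀ {n L} → InP0 n L → InP0 n (conj L)
conj-InP0 {L = L} ((isPart , sum≡n) , rank) =
  (conj-isPartition L isPart , trans (sum-conj L) sum≡n) , conj-rankZero L isPart rank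

×-irrelevant : ∀ {A B : Set} → Irrelevant A → Irrelevant B → Irrelevant (A × B)
×-irrelevant irrA irrB (a , b) (a′ , b′) = cong₂ _,_ (irrA a a′) (irrB b b′)

IsPartition-irrelevant : ∀ {L} → Irrelevant (IsPartition L)
IsPartition-irrelevant = ×-irrelevant (All.irrelevant ≤-irrelevant) (Linked.irrelevant ≤-irrelevant)

InP2-irrelevant : ∀ {n L} → Irrelevant (InP2 n L)
InP2-irrelevant = ×-irrelevant (×-irrelevant (×-irrelevant IsPartition-irrelevant ≡-irrelevant) ≡-irrelevant)
                               (×-irrelevant ≤-irrelevant ≡-irrelevant)

InU5-irrelevant : ∀ {n L} → Irrelevant (InU5 n L)
InU5-irrelevant = ×-irrelevant (×-irrelevant (×-irrelevant IsPartition-irrelevant ≡-irrelevant)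
                                             (×-irrelevant ≤-irrelevant ≤-irrelevant))
                               (×-irrelevant ≡-irrelevant ≡-irrelevant)

Σ-≡-irrelevant : ∀ {B : List ℕ → Set} → (∀ {L} → Irrelevant (B L)) →
                 ∀ {L L′} {p : B L} {q : B L′} → L ≡ L′ → (L , p) ≡ (L′ , q)
Σ-≡-irrelevant irr {p = p} {q} refl = cong (_ ,_) (irr p q)

conj-P₂→U₅ : ∀ {n} → P₂ n → U₅ n
conj-P₂→U₅ (L , p@(p0@(((_ , dec) , _) , _) , _)) =
  conj L , flat⇒InU5 (conj-InP0 p0) (conj-strict⇒flat L _ dec (proj₂ (InP2⇒strict p)))

conj-U₅→P₂ : ∀ {n} → U₅ n → P₂ n
conj-U₅→P₂ (L , u@((((_ , dec) , _) , _) , _)) =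
  conj L , strict⇒InP2 (conj-InP0 (InU5⇒InP0 u)) (conj-flat⇒strict L _ dec (proj₂ (InU5⇒flat u)))

lemma4p4 : (n : ℕ) → P₂ n ⤖ U₅ n
lemma4p4 n = ↔⇒⤖ (mk↔ₛ′ conj-P₂→U₅ conj-U₅→P₂
  (λ (L , (((isPart , _) , _) , _)) → Σ-≡-irrelevant InU5-irrelevant (conj-involutive L isPart))
  (λ (L , (((isPart , _) , _) , _)) → Σ-≡-irrelevant InP2-irrelevant (conj-involutive L isPart)))
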